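{- Let $q\in\mathbb{Q}$ be nonzero, $m\in\mathbb{Q}$ with $m\neq 0,q^2$, $(x_1,y_1)\in\mathcal{D}_m(\mathbb{Q})$, and let $g$ be the function on $E_m$ defined in the context. For all $P,Q\in E_m(\mathbb{Q})$ we have $g(P+Q)\equiv g(P)g(Q)\pmod{(\mathbb{Q}^*)^2}$. In particular, if $P\equiv Q\pmod{2E_m(\mathbb{Q})}$ then $g(P)\equiv g(Q)\pmod{(\mathbb{Q}^*)^2}$.
   Context: Let $\mathcal{D}_m\colon (X^2-q)(Y^2-q)=m$, with projective closure $\overline{\mathcal{D}}_m\colon (X^2-qZ^2)(Y^2-qZ^2)=mZ^4$, and $E_m\colon W^2=T^3+(4q^2-2m)T^2+m^2T$. Fix $(x_1,y_1)\in\mathcal{D}_m(\mathbb{Q})$. The birational map $f\colon\mathcal{D}_m\to E_m$ is $T=(y_1^2-q)\cdot\frac{2x_1(y^2-q)x+(x_1^2+q)y^2+x_1^2y_1^2-2x_1^2q-y_1^2q}{(y-y_1)^2}$, $W=T\cdot\frac{2y_1x(q-y^2)+2x_1y(q-y_1^2)}{y^2-y_1^2}$, sending $(x_1,y_1)$ to the point at infinity. Its inverse $f^{ -1}\colon E_m\to\overline{\mathcal{D}}_m$ is a morphism; write $x\circ f^{ -1}(P)=X(f^{ -1}(P))/Z(f^{ -1}(P))$. Define $g(P)=(x_1^2-q)\big((x\circ f^{ -1}(P))^2-q\big)$. The notation $A\equiv B\pmod{(\mathbb{Q}^*)^2}$ means $A$ and $B$ differ by a factor that is the square of a nonzero rational.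 -}

module Defs where

open import Data.Rational using (ℚ; 0ℚ; 1ℚ; _+_; _-_; _*_; -_; _÷_; _≟_; ≢-nonZero)
open import Data.Product using (Σ; ∃; _×_)
open import Data.Unit using (⊤)
open import Relation.Nullary using (¬_; yes; no)
open import Relation.Binary.PropositionalEquality using (_≡_; _≢_)

-- Small rational constants and a total division (p ÷' 0 = 0).
-- ÷' is only ever used below in branches where the divisor is nonzero.

2ℚ 3ℚ 4ℚ : ℚ
2ℚ = 1ℚ + 1ℚ
3ℚ = 2ℚ + 1ℚ
4ℚ = 2ℚ + 2ℚ

infixl 7 _÷'_
_÷'_ : ℚ → ℚ → ℚ
p ÷' r with r ≟ 0ℚ
... | yes _  = 0ℚ
... | no r≢0 = _÷_ p r {{≢-nonZero r≢0}}

SqEquiv : ℚ → ℚ → Set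
SqEquiv A B = Σ ℚ (λ c → (c ≢ 0ℚ) × (A ≡ c * c * B))

OnD : (q m x y : ℚ) → Set
OnD q m x y = (x * x - q) * (y * y - q) ≡ m

data EPt : Set where
  O  : EPt
  af : ℚ → ℚ → EPt

a2 : (q m : ℚ) → ℚ
a2 q m = 4ℚ * q * q - 2ℚ * m

a4 : (q m : ℚ) → ℚ
a4 q m = m * m

OnE : (q m : ℚ) → EPt → Set
OnE q m O        = ⊤
OnE q m (af T W) = W * W ≡ T * T * T + a2 q m * T * T + a4 q m * T

-- third point from slope l through (x₁,y₁), second abscissa x₂
chord : (q m l x₁ y₁ x₂ : ℚ) → EPt
chord q m l x₁ y₁ x₂ = af x₃ (l * (x₁ - x₃) - y₁)
  where x₃ = l * l - a2 q m - x₁ - x₂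

addE : (q m : ℚ) → EPt → EPt → EPt
addE q m O P = P
addE q m (af x₁ y₁) O = af x₁ y₁
addE q m (af x₁ y₁) (af x₂ y₂) with x₁ ≟ x₂
... | no _  = chord q m ((y₂ - y₁) ÷' (x₂ - x₁)) x₁ y₁ x₂
... | yes _ with y₁ + y₂ ≟ 0ℚ
...   | yes _ = O
...   | no _  = chord q m ((3ℚ * x₁ * x₁ + 2ℚ * a2 q m * x₁ + a4 q m) ÷' (2ℚ * y₁)) x₁ y₁ x₁

-- The birational map f : D_m → E_m attached to the base point (x₁,y₁),
-- extended (as the morphism it is on the smooth affine curve D_m) to all
-- affine points.  'MapsTo q x₁ y₁ x y P' means  f(x,y) = P.
--   * (x₁,y₁) ↦ O;
--   * if y² ≠ y₁², the paper's formulas (denominators cleared);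
--   * the remaining points (±x₁,±y₁) ↦ the limit values of the formulas.

data MapsTo (q x₁ y₁ : ℚ) : ℚ → ℚ → EPt → Set where
  base    : MapsTo q x₁ y₁ x₁ y₁ O
  generic : ∀ {x y T W} →
            y * y ≢ y₁ * y₁ →
            T * ((y - y₁) * (y - y₁)) ≡
              (y₁ * y₁ - q) *
              (2ℚ * x₁ * (y * y - q) * x + (x₁ * x₁ + q) * (y * y)
                 + x₁ * x₁ * (y₁ * y₁) - 2ℚ * (x₁ * x₁) * q - y₁ * y₁ * q) →
            W * (y * y - y₁ * y₁) ≡
              T * (2ℚ * y₁ * x * (q - y * y) + 2ℚ * x₁ * y * (q - y₁ * y₁)) →
            MapsTo q x₁ y₁ x y (af T W)
  special₁ : x₁ ≢ 0ℚ →
            MapsTo q x₁ y₁ (- x₁) y₁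
              (af ((x₁ * x₁ - q) * (x₁ * x₁ - q) * (y₁ * y₁) ÷' (x₁ * x₁))
                  (y₁ * (x₁ * x₁ - q) * (x₁ * x₁ - q) * q * (x₁ * x₁ + y₁ * y₁)
                     ÷' (x₁ * x₁ * x₁)))
  special₂ : y₁ ≢ 0ℚ →
            MapsTo q x₁ y₁ x₁ (- y₁)
              (af (x₁ * x₁ * (y₁ * y₁ - q) * (y₁ * y₁ - q) ÷' (y₁ * y₁))
                  (- (x₁ * (y₁ * y₁ - q) * (y₁ * y₁ - q) * q * (x₁ * x₁ + y₁ * y₁))
                     ÷' (y₁ * y₁ * y₁)))
  special₃ : ¬ (x₁ ≡ 0ℚ × y₁ ≡ 0ℚ) →
            MapsTo q x₁ y₁ (- x₁) (- y₁) (af 0ℚ 0ℚ)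

-- g(P) = (x₁² - q)((x∘f⁻¹(P))² - q), as a relation:  'GVal … P r'  means
-- f⁻¹(P) is an affine rational point (x,y) of D_m and r = g(P).

GVal : (q m x₁ y₁ : ℚ) → EPt → ℚ → Set
GVal q m x₁ y₁ P r =
  Σ ℚ (λ x → Σ ℚ (λ y →
    OnD q m x y × MapsTo q x₁ y₁ x y P × (r ≡ (x₁ * x₁ - q) * (x * x - q))))

{-# OPTIONS --safe #-}
-- Modulo squares, g agrees with the 2-descent map δ attached to the 2-torsion point (0,0) of
-- E_m, which sends (T, W) to T, and O and (0,0) to 1 (the true value at (0,0) is m², a square).
-- On the generic branch of f this rests on the identity g(P) · T(P) · (y - y₁)² = (m (x + x₁))²,
-- obtained from both points lying on D_m; the branches at (±x₁, ±y₁) are direct computations.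
-- δ is a homomorphism to ℚ*/ℚ*²: if a line W = lT + ν meets E_m in abscissae x₁, x₂, x₃, then
-- Vieta gives x₁x₂x₃ = ν², and when ν = 0 the remaining relation x₁x₂ + x₂x₃ + x₃x₁ = m² pairs
-- the nonzero abscissae.
module Submission where

open import Defs
open import Data.Empty using (⊥-elim)
open import Function.Base using (_∘_)
open import Data.Product using (Σ; _×_; _,_; proj₁; proj₂)
open import Data.Rational using (ℚ; 0ℚ; 1ℚ; _+_; _-_; _*_; -_; 1/_; ≢-nonZero)
open import Data.Rational.Properties
  using (_≟_; heytingCommutativeRing; 1≢0; *-assoc; *-inverseˡ;
         *-identityˡ; *-identityʳ; *-zeroˡ; *-zeroʳ; +-identityˡ; +-identityʳ; +-inverseʳ)
open import Algebra.Apartness.Properties.HeytingCommutativeRing heytingCommutativeRing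
  using (x#0y#0→xy#0)
open import Data.Unit using (tt)
open import Relation.Binary.Bundles using (Setoid)
open import Relation.Binary.Structures using (IsEquivalence)
open import Relation.Binary.PropositionalEquality
import Relation.Binary.Reasoning.Setoid as SetoidReasoning
open import Relation.Nullary using (yes; no)
open import Data.Rational.Solver using (module +-*-Solver)
open +-*-Solver using (solve; _:=_; _:+_; _:-_; _:*_; :-_; con)

private variable
  a b c d e u v : ℚ

*-≢0 : a ≢ 0ℚ → b ≢ 0ℚ → a * b ≢ 0ℚ
*-≢0 = x#0y#0→xy#0

x*y≢0⇒x≢0 : a * b ≢ 0ℚ → a ≢ 0ℚ
x*y≢0⇒x≢0 {b = b} ab≢0 refl = ab≢0 (*-zeroˡ b)

x*y≢0⇒y≢0 : a * b ≢ 0ℚ → b ≢ 0ℚ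
x*y≢0⇒y≢0 {a} ab≢0 refl = ab≢0 (*-zeroʳ a)

x*y≡0⇒y≡0 : a ≢ 0ℚ → a * b ≡ 0ℚ → b ≡ 0ℚ
x*y≡0⇒y≡0 {b = b} a≢0 ab≡0 with b ≟ 0ℚ
... | yes b≡0 = b≡0
... | no  b≢0 = ⊥-elim (*-≢0 a≢0 b≢0 ab≡0)

x*x≡0⇒x≡0 : a * a ≡ 0ℚ → a ≡ 0ℚ
x*x≡0⇒x≡0 {a} aa≡0 with a ≟ 0ℚ
... | yes a≡0 = a≡0
... | no  a≢0 = x*y≡0⇒y≡0 a≢0 aa≡0

x≡y⇒x-y≡0 : a ≡ b → a - b ≡ 0ℚ
x≡y⇒x-y≡0 {a} refl = +-inverseʳ a

x-y≡0⇒x≡y : a - b ≡ 0ℚ → a ≡ b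
x-y≡0⇒x≡y {a} {b} a-b≡0 = begin
  a             ≡⟨ solve 2 (λ a b → a := (a :- b) :+ b) refl a b ⟩
  (a - b) + b   ≡⟨ cong (_+ b) a-b≡0 ⟩
  0ℚ + b        ≡⟨ +-identityˡ b ⟩
  b             ∎
  where open ≡-Reasoning

x+y≡0⇒x≡-y : a + b ≡ 0ℚ → a ≡ - b
x+y≡0⇒x≡-y {a} {b} a+b≡0 = begin
  a             ≡⟨ solve 2 (λ a b → a := (a :+ b) :- b) refl a b ⟩
  (a + b) - b   ≡⟨ cong (_- b) a+b≡0 ⟩
  0ℚ - b        ≡⟨ +-identityˡ (- b) ⟩
  - b           ∎
  where open ≡-Reasoning

*-cancelʳ-≡ : c ≢ 0ℚ → a * c ≡ b * c → a ≡ b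
*-cancelʳ-≡ {c} {a} {b} c≢0 ac≡bc = x-y≡0⇒x≡y (x*y≡0⇒y≡0 c≢0 (begin
  c * (a - b)     ≡⟨ solve 3 (λ a b c → c :* (a :- b) := a :* c :- b :* c) refl a b c ⟩
  a * c - b * c   ≡⟨ x≡y⇒x-y≡0 ac≡bc ⟩
  0ℚ              ∎))
  where open ≡-Reasoning

p÷'r*r≡p : ∀ p {r} → r ≢ 0ℚ → p ÷' r * r ≡ p
p÷'r*r≡p p {r} r≢0 with r ≟ 0ℚ
... | yes r≡0 = ⊥-elim (r≢0 r≡0)
... | no  r≢0 = begin
  p * 1/r * r     ≡⟨ *-assoc p 1/r r ⟩
  p * (1/r * r)   ≡⟨ cong (p *_) (*-inverseˡ r) ⟩
  p * 1ℚ          ≡⟨ *-identityʳ p ⟩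
  p               ∎
  where
  open ≡-Reasoning
  instance _ = ≢-nonZero r≢0
  1/r : ℚ
  1/r = 1/ r

b-a*u≡0⇒b≡0 : a ≡ 0ℚ → b - a * u ≡ 0ℚ → b ≡ 0ℚ
b-a*u≡0⇒b≡0 {b = b} {u} refl b-0u≡0 = begin
  b              ≡⟨ +-identityʳ b ⟨
  b - 0ℚ         ≡⟨ cong (λ z → b - z) (*-zeroˡ u) ⟨
  b - 0ℚ * u     ≡⟨ b-0u≡0 ⟩
  0ℚ             ∎
  where open ≡-Reasoning

affine-two-roots : u ≢ v → b - a * u ≡ 0ℚ → b - a * v ≡ 0ℚ → a ≡ 0ℚ × b ≡ 0ℚ
affine-two-roots {u} {v} {b} {a} u≢v root-u root-v = a≡0 , b-a*u≡0⇒b≡0 a≡0 root-u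
  where
  open ≡-Reasoning
  v-u≢0 : v - u ≢ 0ℚ
  v-u≢0 v-u≡0 = u≢v (sym (x-y≡0⇒x≡y v-u≡0))
  a≡0 : a ≡ 0ℚ
  a≡0 = x*y≡0⇒y≡0 v-u≢0 (begin
    (v - u) * a                    ≡⟨ solve 4 (λ u v b a → (v :- u) :* a := (b :- a :* u) :- (b :- a :* v)) refl u v b a ⟩
    (b - a * u) - (b - a * v)      ≡⟨ cong₂ _-_ root-u root-v ⟩
    0ℚ - 0ℚ                        ≡⟨⟩
    0ℚ                             ∎)

x+y≢0⇒x*x≡y*y⇒2x≢0 : a + b ≢ 0ℚ → a * a ≡ b * b → 2ℚ * a ≢ 0ℚ
x+y≢0⇒x*x≡y*y⇒2x≢0 {a} {b} a+b≢0 aa≡bb 2a≡0 = a+b≢0 (begin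
  a + b       ≡⟨ cong (a +_) a≡b ⟨
  a + a       ≡⟨ solve 1 (λ a → a :+ a := con 2ℚ :* a) refl a ⟩
  2ℚ * a      ≡⟨ 2a≡0 ⟩
  0ℚ          ∎)
  where
  open ≡-Reasoning
  a≡b : a ≡ b
  a≡b = x-y≡0⇒x≡y (x*y≡0⇒y≡0 a+b≢0 (begin
    (a + b) * (a - b)   ≡⟨ solve 2 (λ a b → (a :+ b) :* (a :- b) := a :* a :- b :* b) refl a b ⟩
    a * a - b * b       ≡⟨ x≡y⇒x-y≡0 aa≡bb ⟩
    0ℚ                  ∎))

÷'-≢0 : a ≢ 0ℚ → c ≢ 0ℚ → a ÷' c ≢ 0ℚ
÷'-≢0 {a} {c} a≢0 c≢0 a÷'c≡0 = a≢0 (begin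
  a            ≡⟨ p÷'r*r≡p a c≢0 ⟨
  a ÷' c * c   ≡⟨ cong (_* c) a÷'c≡0 ⟩
  0ℚ * c       ≡⟨ *-zeroˡ c ⟩
  0ℚ           ∎)
  where open ≡-Reasoning

SqEquiv-refl : SqEquiv a a
SqEquiv-refl {a} = 1ℚ , 1≢0 , sym (*-identityˡ a)

SqEquiv-sym : SqEquiv a b → SqEquiv b a
SqEquiv-sym {a} {b} (c , c≢0 , a≡ccb) = c⁻¹ , ÷'-≢0 1≢0 c≢0 , (begin
  b                          ≡⟨ *-identityˡ b ⟨
  1ℚ * 1ℚ * b                ≡⟨ cong (λ z → z * z * b) (p÷'r*r≡p 1ℚ c≢0) ⟨
  c⁻¹ * c * (c⁻¹ * c) * b    ≡⟨ solve 3 (λ i c b → i :* c :* (i :* c) :* b := i :* i :* (c :* c :* b)) refl c⁻¹ c b ⟩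
  c⁻¹ * c⁻¹ * (c * c * b)    ≡⟨ cong (c⁻¹ * c⁻¹ *_) a≡ccb ⟨
  c⁻¹ * c⁻¹ * a              ∎)
  where
  open ≡-Reasoning
  c⁻¹ : ℚ
  c⁻¹ = 1ℚ ÷' c

SqEquiv-trans : SqEquiv a b → SqEquiv b c → SqEquiv a c
SqEquiv-trans {a} {b} {c} (d , d≢0 , a≡ddb) (e , e≢0 , b≡eec) = d * e , *-≢0 d≢0 e≢0 , (begin
  a                      ≡⟨ a≡ddb ⟩
  d * d * b              ≡⟨ cong (d * d *_) b≡eec ⟩
  d * d * (e * e * c)    ≡⟨ solve 3 (λ d e c → d :* d :* (e :* e :* c) := d :* e :* (d :* e) :* c) refl d e c ⟩
  d * e * (d * e) * c    ∎)
  where open ≡-Reasoning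

SqEquiv-isEquivalence : IsEquivalence SqEquiv
SqEquiv-isEquivalence = record { refl = SqEquiv-refl ; sym = SqEquiv-sym ; trans = SqEquiv-trans }

SqEquiv-setoid : Setoid _ _
SqEquiv-setoid = record { isEquivalence = SqEquiv-isEquivalence }

SqEquiv-* : SqEquiv a b → SqEquiv c d → SqEquiv (a * c) (b * d)
SqEquiv-* {a} {b} {c} {d} (u , u≢0 , a≡uub) (v , v≢0 , c≡vvd) = u * v , *-≢0 u≢0 v≢0 , (begin
  a * c                      ≡⟨ cong₂ _*_ a≡uub c≡vvd ⟩
  u * u * b * (v * v * d)    ≡⟨ solve 4 (λ u v b d → u :* u :* b :* (v :* v :* d) := u :* v :* (u :* v) :* (b :* d)) refl u v b d ⟩
  u * v * (u * v) * (b * d)  ∎)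
  where open ≡-Reasoning

SqEquiv-square : a ≢ 0ℚ → SqEquiv (a * a) 1ℚ
SqEquiv-square {a} a≢0 = a , a≢0 , sym (*-identityʳ (a * a))

SqEquiv-of-*≡square : e ≢ 0ℚ → u * v ≡ e * e → SqEquiv u v
SqEquiv-of-*≡square {e} {u} {v} e≢0 uv≡ee = w , w≢0 , *-cancelʳ-≡ v≢0 (begin
  u * v              ≡⟨ uv≡ee ⟩
  e * e              ≡⟨ cong₂ _*_ wv≡e wv≡e ⟨
  w * v * (w * v)    ≡⟨ solve 2 (λ w v → w :* v :* (w :* v) := w :* w :* v :* v) refl w v ⟩
  w * w * v * v      ∎)
  where
  open ≡-Reasoning
  w : ℚ
  w = e ÷' v
  v≢0 : v ≢ 0ℚ
  v≢0 refl = *-≢0 e≢0 e≢0 (trans (sym uv≡ee) (*-zeroʳ u))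
  wv≡e : w * v ≡ e
  wv≡e = p÷'r*r≡p e v≢0
  w≢0 : w ≢ 0ℚ
  w≢0 = ÷'-≢0 e≢0 v≢0

-- The 2-descent map

-- δ is opaque so that splitting on `_ ≟ 0ℚ` elsewhere never unfolds it inside a goal.
opaque
  δ : ℚ → ℚ
  δ t with t ≟ 0ℚ
  ... | yes _ = 1ℚ
  ... | no  _ = t

  δ-0 : δ 0ℚ ≡ 1ℚ
  δ-0 = refl

  δ-≢0 : a ≢ 0ℚ → δ a ≡ a
  δ-≢0 {a} a≢0 with a ≟ 0ℚ
  ... | yes a≡0 = ⊥-elim (a≢0 a≡0)
  ... | no  _   = refl

  δ≢0 : ∀ a → δ a ≢ 0ℚ
  δ≢0 a with a ≟ 0ℚ
  ... | yes _   = 1≢0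
  ... | no  a≢0 = a≢0

δᴱ : EPt → ℚ
δᴱ O        = 1ℚ
δᴱ (af t _) = δ t

δᴱ≢0 : ∀ P → δᴱ P ≢ 0ℚ
δᴱ≢0 O        = 1≢0
δᴱ≢0 (af t _) = δ≢0 t

SqEquiv-δ : a ≢ 0ℚ → d ≢ 0ℚ → a * b * (d * d) ≡ e * e →
            (b ≡ 0ℚ → SqEquiv a 1ℚ) → SqEquiv a (δ b)
SqEquiv-δ {a} {d} {b} {e} a≢0 d≢0 abdd≡ee b≡0⇒ with b ≟ 0ℚ
... | yes refl = subst (SqEquiv a) (sym δ-0) (b≡0⇒ refl)
... | no  b≢0 = subst (SqEquiv a) (sym (δ-≢0 b≢0))
  (SqEquiv-trans (SqEquiv-sym (d , d≢0 , refl)) (SqEquiv-of-*≡square e≢0 ddab≡ee))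
  where
  ddab≡ee : d * d * a * b ≡ e * e
  ddab≡ee = trans (solve 3 (λ d a b → d :* d :* a :* b := a :* b :* (d :* d)) refl d a b) abdd≡ee
  e≢0 : e ≢ 0ℚ
  e≢0 = x*y≢0⇒x≢0 (subst (_≢ 0ℚ) abdd≡ee (*-≢0 (*-≢0 a≢0 b≢0) (*-≢0 d≢0 d≢0)))

-- g agrees with δ modulo squares

OnD⇒x²-q≢0 : ∀ {q m x y} → m ≢ 0ℚ → OnD q m x y → x * x - q ≢ 0ℚ
OnD⇒x²-q≢0 m≢0 onD = x*y≢0⇒x≢0 (subst (_≢ 0ℚ) (sym onD) m≢0)

g·numerator≡square : ∀ {q m x₁ y₁ x y} → OnD q m x₁ y₁ → OnD q m x y →
  (x₁ * x₁ - q) * (x * x - q) *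
    ((y₁ * y₁ - q) *
     (2ℚ * x₁ * (y * y - q) * x + (x₁ * x₁ + q) * (y * y)
        + x₁ * x₁ * (y₁ * y₁) - 2ℚ * (x₁ * x₁) * q - y₁ * y₁ * q))
  ≡ m * (x + x₁) * (m * (x + x₁))
g·numerator≡square {q} {m} {x₁} {y₁} {x} {y} onD₁ onD = begin
  _                                         ≡⟨ expand x y x₁ y₁ q ⟩
  D₁ * D * s + r * (D₁ - D)                 ≡⟨ cong₂ (λ u v → u * v * s + r * (u - v)) onD₁ onD ⟩
  m * m * s + r * (m - m)                   ≡⟨ solve 4 (λ m x x₁ r → m :* m :* ((x :+ x₁) :* (x :+ x₁)) :+ r :* (m :- m) := m :* (x :+ x₁) :* (m :* (x :+ x₁))) refl m x x₁ r ⟩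
  m * (x + x₁) * (m * (x + x₁))             ∎
  where
  open ≡-Reasoning
  D₁ D s r : ℚ
  D₁ = (x₁ * x₁ - q) * (y₁ * y₁ - q)
  D  = (x * x - q) * (y * y - q)
  s  = (x + x₁) * (x + x₁)
  r  = (x₁ * x₁ - q) * (x * x - q) * (y₁ * y₁ - q)
  expand : ∀ x y x₁ y₁ q →
    (x₁ * x₁ - q) * (x * x - q) *
      ((y₁ * y₁ - q) *
       (2ℚ * x₁ * (y * y - q) * x + (x₁ * x₁ + q) * (y * y)
          + x₁ * x₁ * (y₁ * y₁) - 2ℚ * (x₁ * x₁) * q - y₁ * y₁ * q))
    ≡ (x₁ * x₁ - q) * (y₁ * y₁ - q) * ((x * x - q) * (y * y - q)) * ((x + x₁) * (x + x₁))
      + (x₁ * x₁ - q) * (x * x - q) * (y₁ * y₁ - q)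
        * ((x₁ * x₁ - q) * (y₁ * y₁ - q) - (x * x - q) * (y * y - q))
  expand = solve 5 (λ x y x₁ y₁ q →
    (x₁ :* x₁ :- q) :* (x :* x :- q) :*
      ((y₁ :* y₁ :- q) :*
       (con 2ℚ :* x₁ :* (y :* y :- q) :* x :+ (x₁ :* x₁ :+ q) :* (y :* y)
          :+ x₁ :* x₁ :* (y₁ :* y₁) :- con 2ℚ :* (x₁ :* x₁) :* q :- y₁ :* y₁ :* q))
    := (x₁ :* x₁ :- q) :* (y₁ :* y₁ :- q) :* ((x :* x :- q) :* (y :* y :- q)) :* ((x :+ x₁) :* (x :+ x₁))
      :+ (x₁ :* x₁ :- q) :* (x :* x :- q) :* (y₁ :* y₁ :- q)
        :* ((x₁ :* x₁ :- q) :* (y₁ :* y₁ :- q) :- (x :* x :- q) :* (y :* y :- q))) refl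

module _ {q m x₁ y₁ : ℚ} (m≢0 : m ≢ 0ℚ) (onD₁ : OnD q m x₁ y₁) where

  private
    k : ℚ
    k = x₁ * x₁ - q

    k≢0 : k ≢ 0ℚ
    k≢0 = OnD⇒x²-q≢0 {q} {m} {x₁} {y₁} m≢0 onD₁

    g[-x₁]≡k² : ∀ {x} → x ≡ - x₁ → k * (x * x - q) ≡ k * k
    g[-x₁]≡k² refl = cong (λ z → k * (z - q)) (solve 1 (λ x → (:- x) :* (:- x) := x :* x) refl x₁)

  g≈δᴱ : ∀ {x y P} → OnD q m x y → MapsTo q x₁ y₁ x y P → SqEquiv (k * (x * x - q)) (δᴱ P)
  g≈δᴱ _ base = SqEquiv-square k≢0
  g≈δᴱ _ (special₁ x₁≢0) =
    subst (λ g → SqEquiv g (δ T)) (sym (g[-x₁]≡k² refl))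
      (SqEquiv-δ {e = k * k * y₁} (*-≢0 k≢0 k≢0) x₁≢0 eq (λ _ → SqEquiv-square k≢0))
    where
    open ≡-Reasoning
    T : ℚ
    T = k * k * (y₁ * y₁) ÷' (x₁ * x₁)
    eq : k * k * T * (x₁ * x₁) ≡ k * k * y₁ * (k * k * y₁)
    eq = begin
      k * k * T * (x₁ * x₁)          ≡⟨ *-assoc (k * k) T (x₁ * x₁) ⟩
      k * k * (T * (x₁ * x₁))        ≡⟨ cong (k * k *_) (p÷'r*r≡p _ (*-≢0 x₁≢0 x₁≢0)) ⟩
      k * k * (k * k * (y₁ * y₁))    ≡⟨ solve 2 (λ k y → k :* k :* (k :* k :* (y :* y)) := k :* k :* y :* (k :* k :* y)) refl k y₁ ⟩
      k * k * y₁ * (k * k * y₁)      ∎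
  g≈δᴱ _ (special₂ y₁≢0) =
    SqEquiv-δ {e = k * x₁ * j} (*-≢0 k≢0 k≢0) y₁≢0 eq (λ _ → SqEquiv-square k≢0)
    where
    open ≡-Reasoning
    j T : ℚ
    j = y₁ * y₁ - q
    T = x₁ * x₁ * j * j ÷' (y₁ * y₁)
    eq : k * k * T * (y₁ * y₁) ≡ k * x₁ * j * (k * x₁ * j)
    eq = begin
      k * k * T * (y₁ * y₁)          ≡⟨ *-assoc (k * k) T (y₁ * y₁) ⟩
      k * k * (T * (y₁ * y₁))        ≡⟨ cong (k * k *_) (p÷'r*r≡p _ (*-≢0 y₁≢0 y₁≢0)) ⟩
      k * k * (x₁ * x₁ * j * j)      ≡⟨ solve 3 (λ k x j → k :* k :* (x :* x :* j :* j) := k :* x :* j :* (k :* x :* j)) refl k x₁ j ⟩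
      k * x₁ * j * (k * x₁ * j)      ∎
  g≈δᴱ _ (special₃ _) =
    subst₂ SqEquiv (sym (g[-x₁]≡k² refl)) (sym δ-0) (SqEquiv-square k≢0)
  g≈δᴱ {x} {y} onD (generic {T = T} y²≢y₁² T-eq _) =
    SqEquiv-δ {e = w} g≢0 y-y₁≢0 key T≡0⇒g≈1
    where
    open ≡-Reasoning
    g D w : ℚ
    g = k * (x * x - q)
    D = (y - y₁) * (y - y₁)
    w = m * (x + x₁)
    g≢0 : g ≢ 0ℚ
    g≢0 = *-≢0 k≢0 (OnD⇒x²-q≢0 {q} {m} {x} {y} m≢0 onD)
    y-y₁≢0 : y - y₁ ≢ 0ℚ
    y-y₁≢0 y-y₁≡0 = y²≢y₁² (cong (λ z → z * z) (x-y≡0⇒x≡y {y} {y₁} y-y₁≡0))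
    key : g * T * D ≡ w * w
    key = begin
      g * T * D     ≡⟨ *-assoc g T D ⟩
      g * (T * D)   ≡⟨ cong (g *_) T-eq ⟩
      _             ≡⟨ g·numerator≡square {q} {m} {x₁} {y₁} {x} {y} onD₁ onD ⟩
      w * w         ∎
    T≡0⇒g≈1 : T ≡ 0ℚ → SqEquiv g 1ℚ
    T≡0⇒g≈1 refl = subst (λ g → SqEquiv g 1ℚ) (sym (g[-x₁]≡k² (x+y≡0⇒x≡-y {x} {x₁} x+x₁≡0))) (SqEquiv-square k≢0)
      where
      w≡0 : w ≡ 0ℚ
      w≡0 = x*x≡0⇒x≡0 {w} (trans (sym key) (trans (cong (_* D) (*-zeroʳ g)) (*-zeroˡ D)))
      x+x₁≡0 : x + x₁ ≡ 0ℚ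
      x+x₁≡0 = x*y≡0⇒y≡0 m≢0 w≡0

  GVal⇒SqEquiv-δᴱ : ∀ {P r} → GVal q m x₁ y₁ P r → SqEquiv r (δᴱ P)
  GVal⇒SqEquiv-δᴱ (_ , _ , onD , mapsTo , refl) = g≈δᴱ onD mapsTo

-- δ is a homomorphism

SqEquiv-δ-of-*≡square : ∀ {b u v} → b ≢ 0ℚ → u * v ≡ b * b → SqEquiv (δ u) (δ v)
SqEquiv-δ-of-*≡square {b} {u} {v} b≢0 uv≡bb =
  subst₂ SqEquiv (sym (δ-≢0 u≢0)) (sym (δ-≢0 v≢0)) (SqEquiv-of-*≡square b≢0 uv≡bb)
  where
  uv≢0 : u * v ≢ 0ℚ
  uv≢0 = subst (_≢ 0ℚ) (sym uv≡bb) (*-≢0 b≢0 b≢0)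
  u≢0 : u ≢ 0ℚ
  u≢0 = x*y≢0⇒x≢0 {u} {v} uv≢0
  v≢0 : v ≢ 0ℚ
  v≢0 = x*y≢0⇒y≢0 {u} {v} uv≢0

δ-vieta-degenerate : ∀ {b x₁ x₂ x₃} → b ≢ 0ℚ → x₁ * x₂ * x₃ ≡ 0ℚ → x₁ * x₂ + x₃ * (x₁ + x₂) ≡ b * b →
           SqEquiv (δ x₃) (δ x₁ * δ x₂)
δ-vieta-degenerate {b} {x₁} {x₂} {x₃} b≢0 prod sum with x₁ ≟ 0ℚ | x₂ ≟ 0ℚ | x₃ ≟ 0ℚ
... | yes refl | _ | _ =
  subst (SqEquiv (δ x₃)) (sym (trans (cong (_* δ x₂) δ-0) (*-identityˡ (δ x₂)))) (SqEquiv-δ-of-*≡square b≢0 (trans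
    (solve 2 (λ x₂ x₃ → x₃ :* x₂ := con 0ℚ :* x₂ :+ x₃ :* (con 0ℚ :+ x₂)) refl x₂ x₃) sum))
... | no _ | yes refl | _ =
  subst (SqEquiv (δ x₃)) (sym (trans (cong (δ x₁ *_) δ-0) (*-identityʳ (δ x₁)))) (SqEquiv-δ-of-*≡square b≢0 (trans
    (solve 2 (λ x₁ x₃ → x₃ :* x₁ := x₁ :* con 0ℚ :+ x₃ :* (x₁ :+ con 0ℚ)) refl x₁ x₃) sum))
... | no x₁≢0 | no x₂≢0 | yes refl =
  subst₂ SqEquiv (sym δ-0) (sym (cong₂ _*_ (δ-≢0 x₁≢0) (δ-≢0 x₂≢0))) (SqEquiv-of-*≡square b≢0 (trans
    (solve 2 (λ x₁ x₂ → con 1ℚ :* (x₁ :* x₂) := x₁ :* x₂ :+ con 0ℚ :* (x₁ :+ x₂)) refl x₁ x₂) sum))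
... | no x₁≢0 | no x₂≢0 | no x₃≢0 = ⊥-elim (*-≢0 (*-≢0 x₁≢0 x₂≢0) x₃≢0 prod)

δ-vieta : ∀ {b s ν x₁ x₂ x₃} → b ≢ 0ℚ →
          x₁ * x₂ * x₃ ≡ ν * ν → x₁ * x₂ + x₃ * (x₁ + x₂) + s * ν ≡ b * b →
          SqEquiv (δ x₃) (δ x₁ * δ x₂)
δ-vieta {b} {s} {ν} {x₁} {x₂} {x₃} b≢0 prod sum with ν ≟ 0ℚ
... | yes refl = δ-vieta-degenerate b≢0 prod (trans
  (solve 2 (λ e s → e := e :+ s :* con 0ℚ) refl (x₁ * x₂ + x₃ * (x₁ + x₂)) s) sum)
... | no ν≢0 = subst₂ SqEquiv (sym (δ-≢0 x₃≢0)) (sym (cong₂ _*_ (δ-≢0 x₁≢0) (δ-≢0 x₂≢0)))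
  (SqEquiv-of-*≡square ν≢0 (trans
    (solve 3 (λ x₁ x₂ x₃ → x₃ :* (x₁ :* x₂) := x₁ :* x₂ :* x₃) refl x₁ x₂ x₃) prod))
  where
  x₁x₂x₃≢0 : x₁ * x₂ * x₃ ≢ 0ℚ
  x₁x₂x₃≢0 = subst (_≢ 0ℚ) (sym prod) (*-≢0 ν≢0 ν≢0)
  x₁x₂≢0 : x₁ * x₂ ≢ 0ℚ
  x₁x₂≢0 = x*y≢0⇒x≢0 {x₁ * x₂} {x₃} x₁x₂x₃≢0
  x₁≢0 : x₁ ≢ 0ℚ
  x₁≢0 = x*y≢0⇒x≢0 {x₁} {x₂} x₁x₂≢0
  x₂≢0 : x₂ ≢ 0ℚ
  x₂≢0 = x*y≢0⇒y≢0 {x₁} {x₂} x₁x₂≢0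
  x₃≢0 : x₃ ≢ 0ℚ
  x₃≢0 = x*y≢0⇒y≢0 {x₁ * x₂} {x₃} x₁x₂x₃≢0

chord-residual : ∀ A B l x₁ y₁ x₂ t →
  let ν  = y₁ - l * x₁
      x₃ = l * l - A - x₁ - x₂ in
  t * t * t + A * t * t + B * t - (l * t + ν) * (l * t + ν)
    ≡ (t - x₁) * (t - x₂) * (t - x₃)
      + ((x₁ * x₂ * x₃ - ν * ν) - (x₁ * x₂ + x₃ * (x₁ + x₂) + 2ℚ * l * ν - B) * t)
chord-residual = solve 7 (λ A B l x₁ y₁ x₂ t →
  let ν  = y₁ :- l :* x₁
      x₃ = l :* l :- A :- x₁ :- x₂ in
  t :* t :* t :+ A :* t :* t :+ B :* t :- (l :* t :+ ν) :* (l :* t :+ ν)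
    := (t :- x₁) :* (t :- x₂) :* (t :- x₃)
      :+ ((x₁ :* x₂ :* x₃ :- ν :* ν) :- (x₁ :* x₂ :+ x₃ :* (x₁ :+ x₂) :+ con 2ℚ :* l :* ν :- B) :* t)) refl

chord-tangency : ∀ A B l x₁ y₁ →
  let ν  = y₁ - l * x₁
      x₃ = l * l - A - x₁ - x₁ in
  x₁ * x₁ + x₃ * (x₁ + x₁) + 2ℚ * l * ν - B
    ≡ l * (2ℚ * y₁) - (3ℚ * x₁ * x₁ + 2ℚ * A * x₁ + B)
chord-tangency = solve 5 (λ A B l x₁ y₁ →
  let ν  = y₁ :- l :* x₁
      x₃ = l :* l :- A :- x₁ :- x₁ in
  x₁ :* x₁ :+ x₃ :* (x₁ :+ x₁) :+ con 2ℚ :* l :* ν :- B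
    := l :* (con 2ℚ :* y₁) :- (con 3ℚ :* x₁ :* x₁ :+ con 2ℚ :* A :* x₁ :+ B)) refl

module Chord (A B l x₁ y₁ x₂ : ℚ) where

  ν x₃ α β : ℚ
  ν  = y₁ - l * x₁
  -- On the line W = l T + ν the curve equation reads (T - x₁)(T - x₂)(T - x₃) + β - α T = 0
  -- (chord-residual); α = β = 0 are the two Vieta relations not forced by the choice of x₃.
  x₃ = l * l - A - x₁ - x₂
  α  = x₁ * x₂ + x₃ * (x₁ + x₂) + 2ℚ * l * ν - B
  β  = x₁ * x₂ * x₃ - ν * ν

  cubic : ℚ → ℚ
  cubic t = t * t * t + A * t * t + B * t

  root : ∀ {t w} → (t - x₁) * (t - x₂) * (t - x₃) ≡ 0ℚ → l * t + ν ≡ w → w * w ≡ cubic t →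
         β - α * t ≡ 0ℚ
  root {t} vanishes refl onCurve = begin
    β - α * t                                       ≡⟨ +-identityˡ (β - α * t) ⟨
    0ℚ + (β - α * t)                                ≡⟨ cong (_+ (β - α * t)) vanishes ⟨
    (t - x₁) * (t - x₂) * (t - x₃) + (β - α * t)   ≡⟨ chord-residual A B l x₁ y₁ x₂ t ⟨
    cubic t - (l * t + ν) * (l * t + ν)             ≡⟨ x≡y⇒x-y≡0 (sym onCurve) ⟩
    0ℚ                                              ∎
    where open ≡-Reasoning

  secant : ∀ y₂ → x₁ ≢ x₂ → y₁ * y₁ ≡ cubic x₁ → y₂ * y₂ ≡ cubic x₂ →
           l * (x₂ - x₁) ≡ y₂ - y₁ → α ≡ 0ℚ × β ≡ 0ℚ
  secant y₂ x₁≢x₂ onCurve₁ onCurve₂ slope = affine-two-roots x₁≢x₂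
    (root (solve 3 (λ x₁ a b → (x₁ :- x₁) :* a :* b := con 0ℚ) refl x₁ (x₁ - x₂) (x₁ - x₃))
          (solve 3 (λ l x₁ y₁ → l :* x₁ :+ (y₁ :- l :* x₁) := y₁) refl l x₁ y₁) onCurve₁)
    (root (solve 3 (λ x₂ a b → a :* (x₂ :- x₂) :* b := con 0ℚ) refl x₂ (x₂ - x₁) (x₂ - x₃))
          on-line₂ onCurve₂)
    where
    open ≡-Reasoning
    on-line₂ : l * x₂ + ν ≡ y₂
    on-line₂ = begin
      l * x₂ + (y₁ - l * x₁)   ≡⟨ solve 4 (λ l x₁ x₂ y₁ → l :* x₂ :+ (y₁ :- l :* x₁) := y₁ :+ l :* (x₂ :- x₁)) refl l x₁ x₂ y₁ ⟩
      y₁ + l * (x₂ - x₁)       ≡⟨ cong (y₁ +_) slope ⟩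
      y₁ + (y₂ - y₁)           ≡⟨ solve 2 (λ y₁ y₂ → y₁ :+ (y₂ :- y₁) := y₂) refl y₁ y₂ ⟩
      y₂                       ∎

  third-point-on-curve : α ≡ 0ℚ → β ≡ 0ℚ →
    (l * (x₁ - x₃) - y₁) * (l * (x₁ - x₃) - y₁) ≡ cubic x₃
  third-point-on-curve α≡0 β≡0 = begin
    (l * (x₁ - x₃) - y₁) * (l * (x₁ - x₃) - y₁)   ≡⟨ solve 4 (λ l x₁ x₃ y₁ → (l :* (x₁ :- x₃) :- y₁) :* (l :* (x₁ :- x₃) :- y₁) := (l :* x₃ :+ (y₁ :- l :* x₁)) :* (l :* x₃ :+ (y₁ :- l :* x₁))) refl l x₁ x₃ y₁ ⟩
    (l * x₃ + ν) * (l * x₃ + ν)                     ≡⟨ x-y≡0⇒x≡y residual≡0 ⟨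
    cubic x₃                                        ∎
    where
    open ≡-Reasoning
    residual≡0 : cubic x₃ - (l * x₃ + ν) * (l * x₃ + ν) ≡ 0ℚ
    residual≡0 = begin
      cubic x₃ - (l * x₃ + ν) * (l * x₃ + ν)            ≡⟨ chord-residual A B l x₁ y₁ x₂ x₃ ⟩
      (x₃ - x₁) * (x₃ - x₂) * (x₃ - x₃) + (β - α * x₃)  ≡⟨ cong₂ (λ u v → (x₃ - x₁) * (x₃ - x₂) * (x₃ - x₃) + (u - v * x₃)) β≡0 α≡0 ⟩
      (x₃ - x₁) * (x₃ - x₂) * (x₃ - x₃) + (0ℚ - 0ℚ * x₃) ≡⟨ solve 3 (λ a b x₃ → a :* b :* (x₃ :- x₃) :+ (con 0ℚ :- con 0ℚ :* x₃) := con 0ℚ) refl (x₃ - x₁) (x₃ - x₂) x₃ ⟩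
      0ℚ                                                  ∎

tangent : ∀ A B l x₁ y₁ → let open Chord A B l x₁ y₁ x₁ in
  y₁ * y₁ ≡ cubic x₁ → l * (2ℚ * y₁) ≡ 3ℚ * x₁ * x₁ + 2ℚ * A * x₁ + B → α ≡ 0ℚ × β ≡ 0ℚ
tangent A B l x₁ y₁ onCurve slope = α≡0 , b-a*u≡0⇒b≡0 α≡0
  (root (solve 3 (λ x₁ a b → (x₁ :- x₁) :* a :* b := con 0ℚ) refl x₁ (x₁ - x₁) (x₁ - x₃))
        (solve 3 (λ l x₁ y₁ → l :* x₁ :+ (y₁ :- l :* x₁) := y₁) refl l x₁ y₁) onCurve)
  where
  open Chord A B l x₁ y₁ x₁
  α≡0 : α ≡ 0ℚ
  α≡0 = trans (chord-tangency A B l x₁ y₁) (x≡y⇒x-y≡0 slope)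

chord-point : ∀ q m l x₁ y₁ x₂ → m ≢ 0ℚ → let open Chord (a2 q m) (a4 q m) l x₁ y₁ x₂ in
  α ≡ 0ℚ × β ≡ 0ℚ →
  OnE q m (chord q m l x₁ y₁ x₂) × SqEquiv (δᴱ (chord q m l x₁ y₁ x₂)) (δ x₁ * δ x₂)
chord-point q m l x₁ y₁ x₂ m≢0 (α≡0 , β≡0) =
  third-point-on-curve α≡0 β≡0 ,
  δ-vieta {s = 2ℚ * l} {ν} {x₁} {x₂} {x₃} m≢0 (x-y≡0⇒x≡y β≡0) (x-y≡0⇒x≡y α≡0)
  where open Chord (a2 q m) (a4 q m) l x₁ y₁ x₂

addE-δ : ∀ {q m P Q} → m ≢ 0ℚ → OnE q m P → OnE q m Q →
         OnE q m (addE q m P Q) × SqEquiv (δᴱ (addE q m P Q)) (δᴱ P * δᴱ Q)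
addE-δ {P = O} {Q} _ _ onQ = onQ , subst (SqEquiv (δᴱ Q)) (sym (*-identityˡ (δᴱ Q))) SqEquiv-refl
addE-δ {P = af x₁ _} {O} _ onP _ = onP , subst (SqEquiv (δ x₁)) (sym (*-identityʳ (δ x₁))) SqEquiv-refl
addE-δ {q} {m} {af x₁ y₁} {af x₂ y₂} m≢0 onP onQ with x₁ ≟ x₂
... | no x₁≢x₂ =
  chord-point q m l x₁ y₁ x₂ m≢0 (Chord.secant (a2 q m) (a4 q m) l x₁ y₁ x₂ y₂ x₁≢x₂ onP onQ slope)
  where
  l : ℚ
  l = (y₂ - y₁) ÷' (x₂ - x₁)
  slope : l * (x₂ - x₁) ≡ y₂ - y₁
  slope = p÷'r*r≡p (y₂ - y₁) (x₁≢x₂ ∘ sym ∘ x-y≡0⇒x≡y)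
... | yes refl with y₁ + y₂ ≟ 0ℚ
...   | yes _ = tt , SqEquiv-sym (SqEquiv-square (δ≢0 x₁))
...   | no y₁+y₂≢0 =
  chord-point q m l x₁ y₁ x₁ m≢0 (tangent (a2 q m) (a4 q m) l x₁ y₁ onP (p÷'r*r≡p F 2y₁≢0))
  where
  F : ℚ
  F = 3ℚ * x₁ * x₁ + 2ℚ * a2 q m * x₁ + a4 q m
  2y₁≢0 : 2ℚ * y₁ ≢ 0ℚ
  2y₁≢0 = x+y≢0⇒x*x≡y*y⇒2x≢0 {y₁} {y₂} y₁+y₂≢0 (trans onP (sym onQ))
  l : ℚ
  l = F ÷' (2ℚ * y₁)

δᴱ-double : ∀ {q m S} → m ≢ 0ℚ → OnE q m S → SqEquiv (δᴱ (addE q m S S)) 1ℚ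
δᴱ-double {S = S} m≢0 onS = SqEquiv-trans (proj₂ (addE-δ m≢0 onS onS)) (SqEquiv-square (δᴱ≢0 S))

theorem6 : (q m x₁ y₁ : ℚ) → q ≢ 0ℚ → m ≢ 0ℚ → m ≢ q * q → OnD q m x₁ y₁ →
    ((P Q : EPt) → OnE q m P → OnE q m Q → (r s t : ℚ) →
       GVal q m x₁ y₁ P r → GVal q m x₁ y₁ Q s →
       GVal q m x₁ y₁ (addE q m P Q) t → SqEquiv t (r * s))
    ×
    ((P Q : EPt) → OnE q m P → OnE q m Q →
       Σ EPt (λ S → OnE q m S × (P ≡ addE q m Q (addE q m S S))) →
       (r s : ℚ) → GVal q m x₁ y₁ P r → GVal q m x₁ y₁ Q s → SqEquiv r s)
theorem6 q m x₁ y₁ _ m≢0 _ onD₁ =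
  (λ P Q onP onQ r s t gP gQ gP+Q → begin
    t                                   ≈⟨ g≈δ gP+Q ⟩
    δᴱ (addE q m P Q)                   ≈⟨ proj₂ (addE-δ m≢0 onP onQ) ⟩
    δᴱ P * δᴱ Q                         ≈⟨ SqEquiv-* (g≈δ gP) (g≈δ gQ) ⟨
    r * s                               ∎) ,
  (λ { P Q _ onQ (S , onS , refl) r s gP gQ → begin
    r                                   ≈⟨ g≈δ gP ⟩
    δᴱ (addE q m Q (addE q m S S))      ≈⟨ proj₂ (addE-δ m≢0 onQ (proj₁ (addE-δ m≢0 onS onS))) ⟩
    δᴱ Q * δᴱ (addE q m S S)            ≈⟨ SqEquiv-* (SqEquiv-refl {δᴱ Q}) (δᴱ-double m≢0 onS) ⟩
    δᴱ Q * 1ℚ                           ≡⟨ *-identityʳ (δᴱ Q) ⟩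
    δᴱ Q                                ≈⟨ g≈δ gQ ⟨
    s                                   ∎ })
  where
  open SetoidReasoning SqEquiv-setoid
  g≈δ : ∀ {P r} → GVal q m x₁ y₁ P r → SqEquiv r (δᴱ P)
  g≈δ = GVal⇒SqEquiv-δᴱ m≢0 onD₁
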